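{- Let the schema consist of a single binary relation symbol $R$, and let $\mathbf{T}$ be the Boolean CQ $\mathbf{T}()\text{ :- }R(y_1,y_2)\wedge R(y_2,y_3)\wedge R(y_3,y_4)\wedge R(y_4,y_5)$. There is no pair $(E^+,E^-)$ of finite sets of acyclic structures (with no distinguished elements) that uniquely characterizes $\mathbf{T}$ with respect to the class of Boolean acyclic connected CQs.
   Context: A Boolean CQ is a conjunctive query with no free variables, i.e. an existentially quantified conjunction of atoms; its canonical structure has its variables as elements and its atoms as facts (no distinguished elements). A structure (no distinguished elements) $A$ is a positive example for a Boolean CQ $q$ if $q$ holds in $A$ (equivalently, the canonical structure of $q$ maps homomorphically to $A$), and a negative example otherwise. Two Boolean CQs are logically equivalent if they hold in the same structures. $(E^+,E^-)$ uniquely characterizes $q$ w.r.t. a class $\mathcal{C}$ of CQs if all of $E^+$ are positive and all of $E^-$ negative for $q$, and every $q'\in\mathcal{C}$ with this property is logically equivalent to $q$. The incidence graph of a structure is the bipartite multigraph on its elements and facts with one edge per occurrence of an element in a fact; a structure is acyclic if its incidence graph has no cycle (including length-2 cycles from parallel edges) and connected if its incidence graph is connected; a CQ is acyclic/connected if its canonical structure is. -}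

module Defs where

open import Data.Nat using (ℕ; suc; _≤_)
open import Data.Fin using (Fin; zero; suc; inject₁; fromℕ; #_)
open import Data.List using (List; []; _∷_; length; lookup)
open import Data.List.Membership.Propositional using (_∈_)
open import Data.List.Relation.Unary.All using (All)
open import Data.Product using (Σ; _×_; _,_; proj₁; proj₂; ∃)
open import Data.Sum using (_⊎_; inj₁; inj₂)
open import Relation.Nullary using (¬_)
open import Relation.Binary.PropositionalEquality using (_≡_)
open import Relation.Binary.Construct.Closure.ReflexiveTransitive using (Star)
open import Function.Bundles using (_⇔_)

record Structure : Set where
  field
    size  : ℕ
    facts : List (Fin size × Fin size)

open Structure public

Elem : Structure → Set
Elem S = Fin (size S)

FactIx : Structure → Set
FactIx S = Fin (length (facts S))

arg : (S : Structure) → FactIx S → Fin 2 → Elem S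
arg S i zero    = proj₁ (lookup (facts S) i)
arg S i (suc _) = proj₂ (lookup (facts S) i)

-- Incidence graph: nodes are elements and facts; one edge per occurrence
-- (fact i, position p) of an element in a fact.
Node : Structure → Set
Node S = Elem S ⊎ FactIx S

IEdge : Structure → Set
IEdge S = FactIx S × Fin 2

Joins : (S : Structure) → IEdge S → Node S → Node S → Set
Joins S (i , p) u v =
  (u ≡ inj₂ i × v ≡ inj₁ (arg S i p)) ⊎ (u ≡ inj₁ (arg S i p) × v ≡ inj₂ i)

-- A cycle in the incidence multigraph: k ≥ 2 pairwise distinct vertices
-- v₀ … v_{k-1} (with v_k = v₀) and k pairwise distinct edges, edge i joining
-- v_i and v_{i+1}.  (k = 2 covers cycles formed by parallel edges.)
record Cycle (S : Structure) : Set where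
  field
    len      : ℕ
    len≥2    : 2 ≤ len
    vtx      : Fin (suc len) → Node S
    closed   : vtx (fromℕ len) ≡ vtx zero
    edge     : Fin len → IEdge S
    joins    : ∀ i → Joins S (edge i) (vtx (inject₁ i)) (vtx (suc i))
    vtx-inj  : ∀ i j → vtx (inject₁ i) ≡ vtx (inject₁ j) → i ≡ j
    edge-inj : ∀ i j → edge i ≡ edge j → i ≡ j

Acyclic : Structure → Set
Acyclic S = ¬ Cycle S

Adjacent : (S : Structure) → Node S → Node S → Set
Adjacent S u v = Σ (IEdge S) λ e → Joins S e u v

Connected : Structure → Set
Connected S = ∀ (u v : Node S) → Star (Adjacent S) u v

IsHom : (A B : Structure) → (Elem A → Elem B) → Set
IsHom A B h = ∀ a b → (a , b) ∈ facts A → (h a , h b) ∈ facts B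

Hom : Structure → Structure → Set
Hom A B = Σ (Elem A → Elem B) (IsHom A B)

-- A Boolean CQ is represented by its canonical structure.
CQ : Set
CQ = Structure

Holds : CQ → Structure → Set
Holds q A = Hom q A

LogEquiv : CQ → CQ → Set
LogEquiv q q' = ∀ (A : Structure) → Holds q A ⇔ Holds q' A

Fits : List Structure → List Structure → CQ → Set
Fits Ep En q = All (Holds q) Ep × All (λ A → ¬ Holds q A) En

UniquelyCharacterizes : List Structure → List Structure → CQ → (CQ → Set) → Set
UniquelyCharacterizes Ep En q C =
  Fits Ep En q × (∀ q' → C q' → Fits Ep En q' → LogEquiv q q')

AcyclicConnectedCQ : CQ → Set
AcyclicConnectedCQ q = Acyclic q × Connected q

T : CQ
T = record
  { size  = 5
  ; facts = (# 0 , # 1) ∷ (# 1 , # 2) ∷ (# 2 , # 3) ∷ (# 3 , # 4) ∷ []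
  }

module Submission where

-- For every m, the zigzag query Q m (8m facts forming a tree of directed
-- paths going up and down) is acyclic and connected, maps to T and is
-- therefore satisfied by every positive example, yet T does not map to it.
-- Q m is also rejected by every acyclic structure N with at most 4m
-- elements that rejects T: if h : Q m → N, follow the image under h of the
-- "spine" walk of Q m of length 4m.  It cannot fold back (gluing two spine
-- elements at distance 2 would let T map into N), and by pigeonhole it
-- repeats an element, so its first repetition closes a cycle of N.  Taking
-- m beyond the sizes of all negative examples, Q m fits (E⁺, E⁻) but is not
-- equivalent to T.

open import Defs
open import Data.Nat using (ℕ; zero; suc; _+_; _*_; _∸_; _≤_; _<_; z≤n; s≤s; _≤ᵇ_)
open import Data.Bool using () renaming (T to True)
open import Data.Vec using ([]; _∷_; lookup)
open import Data.Nat.Properties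
  using ( ≤-refl; ≤-trans; <-trans; ≤-<-trans; <-≤-trans; <⇒≤; ≤-pred; n≤1+n
        ; n<1+n; 1+n≰n; <⇒≢; <⇒≱; ≰⇒>; _≤?_; _<?_; <-cmp; m<1+n⇒m<n∨m≡n
        ; +-mono-≤; +-monoʳ-≤; +-monoʳ-<; +-monoˡ-≤; +-monoˡ-<
        ; m≤m+n; m≤n+m; m≤m*n; +-suc; +-cancelʳ-≡; m∸n+n≡m
        ; m<n⇒0<n∸m; ≤ᵇ⇒≤ )
  renaming (suc-injective to ℕ-suc-injective)
open import Data.Fin using (Fin; zero; suc; toℕ; fromℕ; fromℕ<; inject₁)
open import Data.Fin.Properties
  using (toℕ-injective; toℕ<n; toℕ-fromℕ; toℕ-fromℕ<; toℕ-inject₁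
        ; inject₁-injective; suc-injective; pigeonhole)
  renaming (_≟_ to _≟ᶠ_)
open import Data.List as List using (List; []; _∷_; length; applyUpTo)
open import Data.List.Properties using (length-applyUpTo; lookup-applyUpTo)
open import Data.List.Membership.Propositional using (_∈_)
open import Data.List.Membership.Propositional.Properties
  using (∈-applyUpTo⁺; ∈-applyUpTo⁻)
open import Data.List.Relation.Unary.Any using (here; there; index)
open import Data.List.Relation.Unary.Any.Properties using (lookup-index)
open import Data.List.Relation.Unary.All as All using (All; []; _∷_)
open import Data.Product using (Σ; _×_; _,_; proj₁; proj₂)
open import Data.Sum using (_⊎_; inj₁; inj₂)
open import Data.Sum.Properties using (inj₁-injective; inj₂-injective)
open import Data.Empty using (⊥; ⊥-elim)
open import Relation.Nullary using (¬_; yes; no)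
open import Relation.Binary.PropositionalEquality
  using (_≡_; refl; sym; trans; cong; cong₂; subst; module ≡-Reasoning)
open import Relation.Binary.Definitions using (tri<; tri≈; tri>)
open import Relation.Binary.Construct.Closure.ReflexiveTransitive
  using (Star; ε; _◅_; _◅◅_; reverse)
open import Function.Bundles using (Equivalence)

other : Fin 2 → Fin 2
other zero    = suc zero
other (suc _) = zero

other-≢ : (p : Fin 2) → ¬ other p ≡ p
other-≢ zero       ()
other-≢ (suc zero) ()

other-involutive : (p : Fin 2) → other (other p) ≡ p
other-involutive zero       = refl
other-involutive (suc zero) = refl

position-cases : (p q : Fin 2) → p ≡ q ⊎ p ≡ other q
position-cases zero       zero       = inj₁ refl
position-cases zero       (suc zero) = inj₂ refl
position-cases (suc zero) zero       = inj₂ refl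
position-cases (suc zero) (suc zero) = inj₁ refl

distinct-positions : ∀ {p₁ p₂} (q : Fin 2) → ¬ p₁ ≡ p₂ → p₁ ≡ q ⊎ p₂ ≡ q
distinct-positions {p₁} {p₂} q p₁≢p₂ with position-cases p₁ q | position-cases p₂ q
... | inj₁ eq  | _        = inj₁ eq
... | inj₂ _   | inj₁ eq  = inj₂ eq
... | inj₂ eq₁ | inj₂ eq₂ = ⊥-elim (p₁≢p₂ (trans eq₁ (sym eq₂)))

Joins-sym : (S : Structure) (e : IEdge S) {u v : Node S} → Joins S e u v → Joins S e v u
Joins-sym S e (inj₁ (u≡ , v≡)) = inj₂ (v≡ , u≡)
Joins-sym S e (inj₂ (u≡ , v≡)) = inj₁ (v≡ , u≡)

Adjacent-sym : (S : Structure) {u v : Node S} → Adjacent S u v → Adjacent S v u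
Adjacent-sym S (e , j) = e , Joins-sym S e j

Branching : (S : Structure) → (Node S → Set) → Node S → Set
Branching S V v = Σ (IEdge S) λ e₁ → Σ (IEdge S) λ e₂ → Σ (Node S) λ w₁ → Σ (Node S) λ w₂ →
  ¬ e₁ ≡ e₂ × Joins S e₁ v w₁ × Joins S e₂ v w₂ × V w₁ × V w₂

last-or-inject₁ : ∀ {l} (i : Fin (suc l)) → i ≡ fromℕ l ⊎ Σ (Fin l) (λ j → i ≡ inject₁ j)
last-or-inject₁ {zero}  zero    = inj₁ refl
last-or-inject₁ {suc l} zero    = inj₂ (zero , refl)
last-or-inject₁ {suc l} (suc i) with last-or-inject₁ i
... | inj₁ eq       = inj₁ (cong suc eq)
... | inj₂ (j , eq) = inj₂ (suc j , cong suc eq)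

inject₁≢suc : ∀ {k} (j : Fin k) → ¬ inject₁ j ≡ suc j
inject₁≢suc zero    ()
inject₁≢suc (suc j) eq = inject₁≢suc j (suc-injective eq)

cycle⇒branching-set : ∀ {S} → Cycle S →
  Σ (Node S → Set) λ V → Σ (Node S) λ v₀ → V v₀ × (∀ v → V v → Branching S V v)
cycle⇒branching-set record { len = zero ; len≥2 = () }
cycle⇒branching-set record { len = suc zero ; len≥2 = s≤s () }
cycle⇒branching-set {S} record { len = suc (suc l) ; vtx = vtx ; closed = closed
                                ; edge = edge ; joins = joins ; edge-inj = edge-inj } =
  OnCycle , vtx (suc zero) , (zero , refl) , λ { v (i , refl) → branching i }
  where
  OnCycle : Node S → Set
  OnCycle v = Σ (Fin (suc (suc l))) λ i → vtx (suc i) ≡ v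

  on-cycle : (i : Fin (suc (suc l))) → OnCycle (vtx (inject₁ i))
  on-cycle zero    = fromℕ (suc l) , closed
  on-cycle (suc i) = inject₁ i , refl

  -- vertex i+1 uses the edges i (backwards) and i+1 (wrapping around at the end)
  branching : (i : Fin (suc (suc l))) → Branching S OnCycle (vtx (suc i))
  branching i with last-or-inject₁ i
  ... | inj₁ refl =
    edge i , edge zero , vtx (inject₁ i) , vtx (suc zero) ,
    (λ eq → last≢zero (edge-inj _ _ eq)) , Joins-sym S (edge i) (joins i) ,
    subst (λ z → Joins S (edge zero) z (vtx (suc zero))) (sym closed) (joins zero) ,
    on-cycle i , (zero , refl)
    where
    last≢zero : ¬ fromℕ (suc l) ≡ zero
    last≢zero ()
  ... | inj₂ (j , refl) =
    edge (inject₁ j) , edge (suc j) , vtx (inject₁ (inject₁ j)) , vtx (suc (suc j)) ,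
    (λ eq → inject₁≢suc j (edge-inj _ _ eq)) , Joins-sym S (edge (inject₁ j)) (joins (inject₁ j)) ,
    joins (suc j) , on-cycle (inject₁ j) , (suc j , refl)

no-bounded-ascent : ∀ {A : Set} (key : A → ℕ) (B : ℕ) → (∀ a → key a ≤ B) →
  (P : A → Set) → ∀ {a₀} → P a₀ →
  (∀ a → P a → Σ A λ b → P b × key a < key b) → ⊥
no-bounded-ascent {A} key B bounded P {a₀} Pa₀ ascend =
  1+n≰n (≤-trans (proj₂ (proj₂ (climb (suc B)))) (bounded (proj₁ (climb (suc B)))))
  where
  climb : ∀ n → Σ A λ a → P a × n ≤ key a
  climb zero = a₀ , Pa₀ , z≤n
  climb (suc n) with climb n
  ... | a , Pa , n≤ with ascend a Pa
  ... | b , Pb , a<b = b , Pb , ≤-<-trans n≤ a<b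

-- Fact i has a designated position new i holding
-- element i+1, while its other position holds an element ≤ i: the structure
-- arises from element 0 by attaching, fact after fact, one fresh element.
module Growing (S : Structure) (new : FactIx S → Fin 2)
  (new-elem : ∀ i → toℕ (arg S i (new i)) ≡ suc (toℕ i))
  (old-elem : ∀ i → toℕ (arg S i (other (new i))) ≤ toℕ i) where

  -- The order 0, fact 0, 1, fact 1, 2, … in which the structure is built.
  key : Node S → ℕ
  key (inj₁ a) = toℕ a + toℕ a
  key (inj₂ i) = suc (toℕ i + toℕ i)

  key-bounded : ∀ v → key v ≤ (size S + length (facts S)) + (size S + length (facts S))
  key-bounded (inj₁ a) = +-mono-≤ a≤ a≤
    where
    a≤ : toℕ a ≤ size S + length (facts S)
    a≤ = ≤-trans (<⇒≤ (toℕ<n a)) (m≤m+n _ _)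
  key-bounded (inj₂ i) = +-mono-≤ i< (<⇒≤ i<)
    where
    i< : toℕ i < size S + length (facts S)
    i< = ≤-trans (toℕ<n i) (m≤n+m _ (size S))

  fact<new : ∀ i → key (inj₂ i) < key (inj₁ (arg S i (new i)))
  fact<new i rewrite new-elem i = s≤s (subst (suc (toℕ i + toℕ i) ≤_) (sym (+-suc (toℕ i) (toℕ i))) ≤-refl)

  later-elem-is-new : ∀ i p {a} → arg S i p ≡ a → toℕ i < toℕ a → p ≡ new i
  later-elem-is-new i p refl i<a with position-cases p (new i)
  ... | inj₁ p≡new  = p≡new
  ... | inj₂ refl   = ⊥-elim (1+n≰n (≤-trans i<a (old-elem i)))

  -- A branching fact node has a neighbour of larger key: its new element.
  fact-ascends : ∀ V k → Branching S V (inj₂ k) → Σ (Node S) λ w → V w × key (inj₂ k) < key w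
  fact-ascends V k ((_ , p₁) , (_ , p₂) , w₁ , w₂ , e₁≢e₂ , j₁ , j₂ , V₁ , V₂) with j₁ | j₂
  ... | inj₂ (() , _)  | _
  ... | inj₁ _         | inj₂ (() , _)
  ... | inj₁ (refl , refl) | inj₁ (refl , refl) with distinct-positions (new k) (λ p₁≡p₂ → e₁≢e₂ (cong (k ,_) p₁≡p₂))
  ...   | inj₁ refl = w₁ , V₁ , fact<new k
  ...   | inj₂ refl = w₂ , V₂ , fact<new k

  -- A branching element node a has a neighbouring fact i ≥ a: two facts
  -- below a would both have a as new element, hence coincide.
  element-ascends : ∀ V a → Branching S V (inj₁ a) → Σ (Node S) λ w → V w × key (inj₁ a) < key w
  element-ascends V a ((i₁ , p₁) , (i₂ , p₂) , w₁ , w₂ , e₁≢e₂ , j₁ , j₂ , V₁ , V₂) with j₁ | j₂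
  ... | inj₁ (() , _) | _
  ... | inj₂ _        | inj₁ (() , _)
  ... | inj₂ (a≡₁ , refl) | inj₂ (a≡₂ , refl) with toℕ a ≤? toℕ i₁ | toℕ a ≤? toℕ i₂
  ...   | yes a≤i₁ | _        = inj₂ i₁ , V₁ , s≤s (+-mono-≤ a≤i₁ a≤i₁)
  ...   | no _     | yes a≤i₂ = inj₂ i₂ , V₂ , s≤s (+-mono-≤ a≤i₂ a≤i₂)
  ...   | no a≰i₁  | no a≰i₂  = ⊥-elim (e₁≢e₂ same-edge)
    where
    q₁ : arg S i₁ p₁ ≡ a
    q₁ = sym (inj₁-injective a≡₁)
    q₂ : arg S i₂ p₂ ≡ a
    q₂ = sym (inj₁-injective a≡₂)
    same-edge : (i₁ , p₁) ≡ (i₂ , p₂)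
    same-edge with later-elem-is-new i₁ p₁ q₁ (≰⇒> a≰i₁) | later-elem-is-new i₂ p₂ q₂ (≰⇒> a≰i₂)
    ... | refl | refl with toℕ-injective {i = i₁} {j = i₂}
          (ℕ-suc-injective (trans (sym (new-elem i₁)) (trans (cong toℕ (trans q₁ (sym q₂))) (new-elem i₂))))
    ... | refl = refl

  -- On the vertices of a cycle the key could be increased forever.
  acyclic : Acyclic S
  acyclic cyc with cycle⇒branching-set cyc
  ... | V , v₀ , Vv₀ , branching =
    no-bounded-ascent key _ key-bounded V Vv₀ ascends
    where
    ascends : ∀ v → V v → Σ (Node S) λ w → V w × key v < key w
    ascends (inj₁ a) Va = element-ascends V a (branching _ Va)
    ascends (inj₂ k) Vk = fact-ascends V k (branching _ Vk)

  module Rooted (root : Elem S)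
    (root-or-new : ∀ a → a ≡ root ⊎ Σ (FactIx S) λ i → arg S i (new i) ≡ a) where

    -- Descend from an element towards the root through the fact that
    -- attached it (fuel n bounds the element's number).
    path-to-root : ∀ n (a : Elem S) → toℕ a ≤ n → Star (Adjacent S) (inj₁ a) (inj₁ root)
    path-via-fact : ∀ n i → suc (toℕ i) ≤ n → Star (Adjacent S) (inj₁ (arg S i (new i))) (inj₁ root)

    path-to-root n a a≤n with root-or-new a
    ... | inj₁ refl       = ε
    ... | inj₂ (i , refl) = path-via-fact n i (subst (_≤ n) (new-elem i) a≤n)

    path-via-fact (suc n) i (s≤s i≤n) =
      ((i , new i) , inj₂ (refl , refl)) ◅ ((i , other (new i)) , inj₁ (refl , refl)) ◅
      path-to-root n (arg S i (other (new i))) (≤-trans (old-elem i) i≤n)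

    node-to-root : ∀ v → Star (Adjacent S) v (inj₁ root)
    node-to-root (inj₁ a) = path-to-root (toℕ a) a ≤-refl
    node-to-root (inj₂ i) = ((i , new i) , inj₁ (refl , refl)) ◅ node-to-root (inj₁ (arg S i (new i)))

    connected : Connected S
    connected u v = node-to-root u ◅◅ reverse (Adjacent-sym S) (node-to-root v)

-- Cycles of the incidence graph alternate elements and facts, so they are
-- indexed through even and odd numbers.
double : ℕ → ℕ
double zero    = zero
double (suc q) = suc (suc (double q))

data Parity : ℕ → Set where
  even : ∀ q → Parity (double q)
  odd  : ∀ q → Parity (suc (double q))

parity : ∀ n → Parity n
parity zero = even zero
parity (suc zero) = odd zero
parity (suc (suc n)) with parity n
... | even q = even (suc q)
... | odd q  = odd (suc q)

even<double⇒< : ∀ {q d} → double q < double d → q < d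
even<double⇒< {zero}  {suc d} _               = s≤s z≤n
even<double⇒< {suc q} {suc d} (s≤s (s≤s q<d)) = s≤s (even<double⇒< q<d)

odd<double⇒< : ∀ {q d} → suc (double q) < double d → q < d
odd<double⇒< {zero}  {suc d} _               = s≤s z≤n
odd<double⇒< {suc q} {suc d} (s≤s (s≤s q<d)) = s≤s (odd<double⇒< q<d)

interleave : {A : Set} → (ℕ → A) → (ℕ → A) → ℕ → A
interleave a b zero          = a 0
interleave a b (suc zero)    = b 0
interleave a b (suc (suc n)) = interleave (λ t → a (suc t)) (λ t → b (suc t)) n

interleave-even : ∀ {A : Set} (a b : ℕ → A) q → interleave a b (double q) ≡ a q
interleave-even a b zero    = refl
interleave-even a b (suc q) = interleave-even (λ t → a (suc t)) (λ t → b (suc t)) q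

interleave-odd : ∀ {A : Set} (a b : ℕ → A) q → interleave a b (suc (double q)) ≡ b q
interleave-odd a b zero    = refl
interleave-odd a b (suc q) = interleave-odd (λ t → a (suc t)) (λ t → b (suc t)) q

Traversal : (N : Structure) → Elem N → Elem N → Set
Traversal N x y = Σ (IEdge N) λ e → arg N (proj₁ e) (proj₂ e) ≡ x × arg N (proj₁ e) (other (proj₂ e)) ≡ y

-- A closed walk e 0, …, e d = e 0 through distinct elements that never
-- returns to the element visited two steps before traces a cycle of the
-- incidence graph: element e t, the traversed fact, element e (t+1), …
module ClosedWalk (N : Structure) (d : ℕ) (d≥1 : 1 ≤ d) (e : ℕ → Elem N)
  (step : ∀ t → t < d → Traversal N (e t) (e (suc t)))
  (closed : e d ≡ e 0)
  (distinct : ∀ s t → s < d → t < d → e s ≡ e t → s ≡ t)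
  (no-return : ∀ s → suc (suc s) ≤ d → ¬ e s ≡ e (suc (suc s))) where

  open ≡-Reasoning

  -- the traversal used at step t (extended arbitrarily beyond d)
  used : ℕ → IEdge N
  used t with t <? d
  ... | yes t<d = proj₁ (step t t<d)
  ... | no _    = proj₁ (step 0 d≥1)

  f : ℕ → FactIx N
  f t = proj₁ (used t)

  p : ℕ → Fin 2
  p t = proj₂ (used t)

  used-spec : ∀ t → t < d → arg N (f t) (p t) ≡ e t × arg N (f t) (other (p t)) ≡ e (suc t)
  used-spec t t<d with t <? d
  ... | yes t<d′ = proj₂ (step t t<d′)
  ... | no t≮d   = ⊥-elim (t≮d t<d)

  from : ∀ t → t < d → arg N (f t) (p t) ≡ e t
  from t t<d = proj₁ (used-spec t t<d)

  to : ∀ t → t < d → arg N (f t) (other (p t)) ≡ e (suc t)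
  to t t<d = proj₂ (used-spec t t<d)

  -- Reusing the fact of step s at a later step t means either revisiting
  -- e s (same direction) or walking straight back to it (t = s+1).
  f-distinct< : ∀ s t → s < t → t < d → ¬ f s ≡ f t
  f-distinct< s t s<t t<d fs≡ft with position-cases (p s) (p t)
  ... | inj₁ ps≡pt = <⇒≢ s<t (distinct s t s<d t<d es≡et)
    where
    s<d : s < d
    s<d = <-trans s<t t<d
    es≡et : e s ≡ e t
    es≡et = begin
      e s                ≡⟨ sym (from s s<d) ⟩
      arg N (f s) (p s)  ≡⟨ cong₂ (arg N) fs≡ft ps≡pt ⟩
      arg N (f t) (p t)  ≡⟨ from t t<d ⟩
      e t                ∎
  ... | inj₂ ps≡opt =
    no-return s (subst (_≤ d) (cong suc (sym s+1≡t)) t<d)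
                (subst (λ z → e s ≡ e (suc z)) (sym s+1≡t) es≡et+1)
    where
    s<d : s < d
    s<d = <-trans s<t t<d
    es≡et+1 : e s ≡ e (suc t)
    es≡et+1 = begin
      e s                        ≡⟨ sym (from s s<d) ⟩
      arg N (f s) (p s)          ≡⟨ cong₂ (arg N) fs≡ft ps≡opt ⟩
      arg N (f t) (other (p t))  ≡⟨ to t t<d ⟩
      e (suc t)                  ∎
    es+1≡et : e (suc s) ≡ e t
    es+1≡et = begin
      e (suc s)                  ≡⟨ sym (to s s<d) ⟩
      arg N (f s) (other (p s))  ≡⟨ cong₂ (arg N) fs≡ft (cong other ps≡opt) ⟩
      arg N (f t) (other (other (p t))) ≡⟨ cong (arg N (f t)) (other-involutive (p t)) ⟩
      arg N (f t) (p t)          ≡⟨ from t t<d ⟩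
      e t                        ∎
    s+1≡t : suc s ≡ t
    s+1≡t = distinct (suc s) t (≤-<-trans s<t t<d) t<d es+1≡et

  f-distinct : ∀ s t → s < d → t < d → f s ≡ f t → s ≡ t
  f-distinct s t s<d t<d eq with <-cmp s t
  ... | tri< s<t _ _ = ⊥-elim (f-distinct< s t s<t t<d eq)
  ... | tri≈ _ s≡t _ = s≡t
  ... | tri> _ _ t<s = ⊥-elim (f-distinct< t s t<s s<d (sym eq))

  vertex : ℕ → Node N
  vertex = interleave (λ t → inj₁ (e t)) (λ t → inj₂ (f t))

  edge : ℕ → IEdge N
  edge = interleave (λ t → f t , p t) (λ t → f t , other (p t))

  vertex-even : ∀ q → vertex (double q) ≡ inj₁ (e q)
  vertex-even = interleave-even (λ t → inj₁ (e t)) (λ t → inj₂ (f t))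

  vertex-odd : ∀ q → vertex (suc (double q)) ≡ inj₂ (f q)
  vertex-odd = interleave-odd (λ t → inj₁ (e t)) (λ t → inj₂ (f t))

  edge-even : ∀ q → edge (double q) ≡ (f q , p q)
  edge-even = interleave-even (λ t → f t , p t) (λ t → f t , other (p t))

  edge-odd : ∀ q → edge (suc (double q)) ≡ (f q , other (p q))
  edge-odd = interleave-odd (λ t → f t , p t) (λ t → f t , other (p t))

  edge-joins : ∀ n → n < double d → Joins N (edge n) (vertex n) (vertex (suc n))
  edge-joins n n< with parity n
  ... | even q rewrite edge-even q | vertex-even q | vertex-odd q =
    inj₂ (cong inj₁ (sym (from q (even<double⇒< n<))) , refl)
  ... | odd q rewrite edge-odd q | vertex-odd q | vertex-even (suc q) =
    inj₁ (refl , cong inj₁ (sym (to q (odd<double⇒< n<))))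

  vertex-distinct : ∀ n n′ → n < double d → n′ < double d → vertex n ≡ vertex n′ → n ≡ n′
  vertex-distinct n n′ n< n′< eq with parity n | parity n′
  ... | even q | even q′ rewrite vertex-even q | vertex-even q′ =
    cong double (distinct q q′ (even<double⇒< n<) (even<double⇒< n′<) (inj₁-injective eq))
  ... | even q | odd q′ rewrite vertex-even q | vertex-odd q′ with () ← eq
  ... | odd q | even q′ rewrite vertex-odd q | vertex-even q′ with () ← eq
  ... | odd q | odd q′ rewrite vertex-odd q | vertex-odd q′ =
    cong (λ z → suc (double z)) (f-distinct q q′ (odd<double⇒< n<) (odd<double⇒< n′<) (inj₂-injective eq))

  edge-distinct : ∀ n n′ → n < double d → n′ < double d → edge n ≡ edge n′ → n ≡ n′
  edge-distinct n n′ n< n′< eq with parity n | parity n′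
  ... | even q | even q′ rewrite edge-even q | edge-even q′ =
    cong double (f-distinct q q′ (even<double⇒< n<) (even<double⇒< n′<) (cong proj₁ eq))
  ... | odd q | odd q′ rewrite edge-odd q | edge-odd q′ =
    cong (λ z → suc (double z)) (f-distinct q q′ (odd<double⇒< n<) (odd<double⇒< n′<) (cong proj₁ eq))
  ... | even q | odd q′ rewrite edge-even q | edge-odd q′
    with refl ← f-distinct q q′ (even<double⇒< n<) (odd<double⇒< n′<) (cong proj₁ eq) =
    ⊥-elim (other-≢ (p q) (sym (cong proj₂ eq)))
  ... | odd q | even q′ rewrite edge-odd q | edge-even q′
    with refl ← f-distinct q q′ (odd<double⇒< n<) (even<double⇒< n′<) (cong proj₁ eq) =
    ⊥-elim (other-≢ (p q) (cong proj₂ eq))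

  cycle : Cycle N
  cycle = record
    { len      = double d
    ; len≥2    = double≥2 d≥1
    ; vtx      = λ i → vertex (toℕ i)
    ; closed   = trans (cong vertex (toℕ-fromℕ (double d))) (trans (vertex-even d) (cong inj₁ closed))
    ; edge     = λ i → edge (toℕ i)
    ; joins    = λ i → subst (λ z → Joins N (edge (toℕ i)) (vertex z) (vertex (suc (toℕ i))))
                           (sym (toℕ-inject₁ i)) (edge-joins (toℕ i) (toℕ<n i))
    ; vtx-inj  = λ i j eq → inject₁-injective (toℕ-injective
                   (vertex-distinct _ _ (inject₁< i) (inject₁< j) eq))
    ; edge-inj = λ i j eq → toℕ-injective (edge-distinct _ _ (toℕ<n i) (toℕ<n j) eq)
    }
    where
    double≥2 : ∀ {d} → 1 ≤ d → 2 ≤ double d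
    double≥2 {suc d} _ = s≤s (s≤s z≤n)
    inject₁< : (i : Fin (double d)) → toℕ (inject₁ i) < double d
    inject₁< i = subst (_< double d) (sym (toℕ-inject₁ i)) (toℕ<n i)

-- Fact k is R(zigzag k); in each block of eight facts, with
-- elements 0‥8 shifted by 8 per block, the facts are
--   0→1, 1→2, 2→3, 1→4, 5→4, 6→5, 7→6, 8→5,
-- so fact k introduces the element k+1 and 8 starts the next block.

pattern +4 k = suc (suc (suc (suc k)))
pattern +8 k = +4 (+4 k)

zigzag : ℕ → ℕ × ℕ
zigzag 0 = 0 , 1
zigzag 1 = 1 , 2
zigzag 2 = 2 , 3
zigzag 3 = 1 , 4
zigzag 4 = 5 , 4
zigzag 5 = 6 , 5
zigzag 6 = 7 , 6
zigzag 7 = 8 , 5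
zigzag (+8 k) = 8 + proj₁ (zigzag k) , 8 + proj₂ (zigzag k)

endpoint : Fin 2 → ℕ → ℕ
endpoint zero    k = proj₁ (zigzag k)
endpoint (suc _) k = proj₂ (zigzag k)

new-pos : ℕ → Fin 2
new-pos 0 = suc zero
new-pos 1 = suc zero
new-pos 2 = suc zero
new-pos 3 = suc zero
new-pos 4 = zero
new-pos 5 = zero
new-pos 6 = zero
new-pos 7 = zero
new-pos (+8 k) = new-pos k

new-endpoint : ∀ k → endpoint (new-pos k) k ≡ suc k
new-endpoint 0 = refl
new-endpoint 1 = refl
new-endpoint 2 = refl
new-endpoint 3 = refl
new-endpoint 4 = refl
new-endpoint 5 = refl
new-endpoint 6 = refl
new-endpoint 7 = refl
new-endpoint (+8 k) with new-pos k | new-endpoint k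
... | zero     | eq = cong (8 +_) eq
... | suc zero | eq = cong (8 +_) eq

old-endpoint : ∀ k → endpoint (other (new-pos k)) k ≤ k
old-endpoint 0 = z≤n
old-endpoint 1 = s≤s z≤n
old-endpoint 2 = s≤s (s≤s z≤n)
old-endpoint 3 = s≤s z≤n
old-endpoint 4 = s≤s (s≤s (s≤s (s≤s z≤n)))
old-endpoint 5 = s≤s (s≤s (s≤s (s≤s (s≤s z≤n))))
old-endpoint 6 = s≤s (s≤s (s≤s (s≤s (s≤s (s≤s z≤n)))))
old-endpoint 7 = s≤s (s≤s (s≤s (s≤s (s≤s z≤n))))
old-endpoint (+8 k) with new-pos k | old-endpoint k
... | zero     | le = +-monoʳ-≤ 8 le
... | suc zero | le = +-monoʳ-≤ 8 le

endpoint≤ : ∀ p k → endpoint p k ≤ suc k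
endpoint≤ p k with position-cases p (new-pos k)
... | inj₁ refl = subst (_≤ suc k) (sym (new-endpoint k)) ≤-refl
... | inj₂ refl = ≤-trans (old-endpoint k) (n≤1+n k)

-- The level 1,2,3,4,3,2,1,0 of the elements of a block: it grows by one
-- along every fact and stays in 0‥4, which is how the zigzag maps to T.
level : ℕ → ℕ
level 0 = 1
level 1 = 2
level 2 = 3
level 3 = 4
level 4 = 3
level 5 = 2
level 6 = 1
level 7 = 0
level (+8 k) = level k

level-step : ∀ k → level (proj₂ (zigzag k)) ≡ suc (level (proj₁ (zigzag k))) × level (proj₁ (zigzag k)) ≤ 3
level-step 0 = refl , s≤s z≤n
level-step 1 = refl , s≤s (s≤s z≤n)
level-step 2 = refl , s≤s (s≤s (s≤s z≤n))
level-step 3 = refl , s≤s (s≤s z≤n)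
level-step 4 = refl , s≤s (s≤s z≤n)
level-step 5 = refl , s≤s z≤n
level-step 6 = refl , z≤n
level-step 7 = refl , s≤s z≤n
level-step (+8 k) = level-step k

-- The rank 0,1,2,3,3,2,1,0 of the elements of a block: it increases
-- strictly along every fact and stays in 0‥3, so no directed path of length
-- 4 exists, which is why T does not map to the zigzag.
rank : ℕ → ℕ
rank 0 = 0
rank 1 = 1
rank 2 = 2
rank 3 = 3
rank 4 = 3
rank 5 = 2
rank 6 = 1
rank 7 = 0
rank (+8 k) = rank k

rank≤3 : ∀ x → rank x ≤ 3
rank≤3 0 = z≤n
rank≤3 1 = s≤s z≤n
rank≤3 2 = s≤s (s≤s z≤n)
rank≤3 3 = s≤s (s≤s (s≤s z≤n))
rank≤3 4 = s≤s (s≤s (s≤s z≤n))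
rank≤3 5 = s≤s (s≤s z≤n)
rank≤3 6 = s≤s z≤n
rank≤3 7 = z≤n
rank≤3 (+8 k) = rank≤3 k

rank-increases : ∀ k → rank (proj₁ (zigzag k)) < rank (proj₂ (zigzag k))
rank-increases 0 = s≤s z≤n
rank-increases 1 = s≤s (s≤s z≤n)
rank-increases 2 = s≤s (s≤s (s≤s z≤n))
rank-increases 3 = s≤s (s≤s z≤n)
rank-increases 4 = s≤s (s≤s (s≤s z≤n))
rank-increases 5 = s≤s (s≤s z≤n)
rank-increases 6 = s≤s z≤n
rank-increases 7 = s≤s z≤n
rank-increases (+8 k) = rank-increases k

-- The element numbered x of Fin (suc n), saturating at n.
clamp : (n x : ℕ) → Fin (suc n)
clamp n       zero    = zero
clamp zero    (suc x) = zero
clamp (suc n) (suc x) = suc (clamp n x)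

toℕ-clamp : ∀ n x → x ≤ n → toℕ (clamp n x) ≡ x
toℕ-clamp n       zero    _         = refl
toℕ-clamp (suc n) (suc x) (s≤s x≤n) = cong suc (toℕ-clamp n x x≤n)

zigzag-fin : (m : ℕ) → ℕ → Fin (suc (m * 8)) × Fin (suc (m * 8))
zigzag-fin m k = clamp (m * 8) (proj₁ (zigzag k)) , clamp (m * 8) (proj₂ (zigzag k))

Q : ℕ → Structure
Q m = record { size = suc (m * 8) ; facts = applyUpTo (zigzag-fin m) (m * 8) }

record ZFact (m u v : ℕ) : Set where
  constructor fact-no
  field
    k     : ℕ
    k<    : k < m * 8
    is-uv : zigzag k ≡ (u , v)

module _ (m : ℕ) where

  Q-fact⁺ : ∀ {u v} → ZFact m u v → (clamp (m * 8) u , clamp (m * 8) v) ∈ facts (Q m)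
  Q-fact⁺ (fact-no k k< refl) = ∈-applyUpTo⁺ (zigzag-fin m) k<

  Q-fact⁻ : ∀ {a b} → (a , b) ∈ facts (Q m) →
    Σ ℕ λ k → toℕ a ≡ proj₁ (zigzag k) × toℕ b ≡ proj₂ (zigzag k)
  Q-fact⁻ a,b∈ with ∈-applyUpTo⁻ (zigzag-fin m) a,b∈
  ... | k , k< , refl = k , toℕ-clamp _ _ (≤-trans (endpoint≤ zero k) k<)
                          , toℕ-clamp _ _ (≤-trans (endpoint≤ (suc zero) k) k<)

  fact-index< : (i : FactIx (Q m)) → toℕ i < m * 8
  fact-index< i = subst (toℕ i <_) (length-applyUpTo (zigzag-fin m) (m * 8)) (toℕ<n i)

  arg-Q : ∀ i p → toℕ (arg (Q m) i p) ≡ endpoint p (toℕ i)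
  arg-Q i zero rewrite lookup-applyUpTo (zigzag-fin m) (m * 8) i =
    toℕ-clamp _ _ (≤-trans (endpoint≤ zero (toℕ i)) (fact-index< i))
  arg-Q i (suc zero) rewrite lookup-applyUpTo (zigzag-fin m) (m * 8) i =
    toℕ-clamp _ _ (≤-trans (endpoint≤ (suc zero) (toℕ i)) (fact-index< i))

  Q-new : FactIx (Q m) → Fin 2
  Q-new i = new-pos (toℕ i)

  Q-new-elem : ∀ i → toℕ (arg (Q m) i (Q-new i)) ≡ suc (toℕ i)
  Q-new-elem i = trans (arg-Q i (Q-new i)) (new-endpoint (toℕ i))

  Q-old-elem : ∀ i → toℕ (arg (Q m) i (other (Q-new i))) ≤ toℕ i
  Q-old-elem i = subst (_≤ toℕ i) (sym (arg-Q i (other (Q-new i)))) (old-endpoint (toℕ i))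

  Q-root-or-new : ∀ a → a ≡ zero ⊎ Σ (FactIx (Q m)) λ i → arg (Q m) i (Q-new i) ≡ a
  Q-root-or-new zero    = inj₁ refl
  Q-root-or-new (suc a) = inj₂ (i , toℕ-injective (trans (Q-new-elem i) (cong suc (toℕ-fromℕ< _))))
    where
    i : FactIx (Q m)
    i = fromℕ< (subst (toℕ a <_) (sym (length-applyUpTo (zigzag-fin m) (m * 8))) (toℕ<n a))

  Q-acyclic : Acyclic (Q m)
  Q-acyclic = Growing.acyclic (Q m) Q-new Q-new-elem Q-old-elem

  Q-connected : Connected (Q m)
  Q-connected = Growing.Rooted.connected (Q m) Q-new Q-new-elem Q-old-elem zero Q-root-or-new

  Q→T : Hom (Q m) T
  Q→T = (λ x → clamp 4 (level (toℕ x))) , level-hom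
    where
    T-fact : ∀ l → l ≤ 3 → (clamp 4 l , clamp 4 (suc l)) ∈ facts T
    T-fact 0 _ = here refl
    T-fact 1 _ = there (here refl)
    T-fact 2 _ = there (there (here refl))
    T-fact 3 _ = there (there (there (here refl)))
    T-fact (+4 l) (s≤s (s≤s (s≤s ())))
    level-hom : IsHom (Q m) T (λ x → clamp 4 (level (toℕ x)))
    level-hom a b a,b∈ with Q-fact⁻ a,b∈
    ... | k , a≡ , b≡ rewrite a≡ | b≡ | proj₁ (level-step k) = T-fact _ (proj₂ (level-step k))

  -- The image of T in Q m would be a path along which the rank rises 4 times.
  T↛Q : ¬ Hom T (Q m)
  T↛Q (h , hom) = <⇒≱ 3<rank₄ (rank≤3 (toℕ (h (+4 zero))))
    where
    up : ∀ {a b} → (a , b) ∈ facts (Q m) → rank (toℕ a) < rank (toℕ b)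
    up a,b∈ with Q-fact⁻ a,b∈
    ... | k , a≡ , b≡ rewrite a≡ | b≡ = rank-increases k
    3<rank₄ : 3 < rank (toℕ (h (+4 zero)))
    3<rank₄ = ≤-<-trans (≤-<-trans (≤-<-trans (≤-<-trans z≤n
                (up (hom _ _ (here refl))))
                (up (hom _ _ (there (here refl)))))
                (up (hom _ _ (there (there (here refl))))))
                (up (hom _ _ (there (there (there (here refl))))))

first-block : ∀ {m} k → {True (suc k ≤ᵇ 8)} → ZFact (suc m) (proj₁ (zigzag k)) (proj₂ (zigzag k))
first-block {m} k {k<8} = fact-no k (≤-trans (≤ᵇ⇒≤ (suc k) 8 k<8) (m≤m+n 8 (m * 8))) refl

ZFact-shift : ∀ {m u v} → ZFact m u v → ZFact (suc m) (8 + u) (8 + v)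
ZFact-shift (fact-no k k< refl) = fact-no (8 + k) (+-monoʳ-< 8 k<) refl

-- The spine 0, 1, 4, 5, 8, 9, … of the zigzag (the elements of level 1, 2,
-- 3, 2 in each block): consecutive spine elements share a fact.
spine : ℕ → ℕ
spine 0 = 0
spine 1 = 1
spine 2 = 4
spine 3 = 5
spine (+4 t) = 8 + spine t

spine-fact : ∀ m t → t < m * 4 → ZFact m (spine t) (spine (suc t)) ⊎ ZFact m (spine (suc t)) (spine t)
spine-fact (suc m) 0 _ = inj₁ (first-block 0)
spine-fact (suc m) 1 _ = inj₁ (first-block 3)
spine-fact (suc m) 2 _ = inj₂ (first-block 4)
spine-fact (suc m) 3 _ = inj₂ (first-block 7)
spine-fact (suc m) (+4 t) (s≤s (s≤s (s≤s (s≤s t<)))) with spine-fact m t t<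
... | inj₁ uv = inj₁ (ZFact-shift uv)
... | inj₂ vu = inj₂ (ZFact-shift vu)

-- R(u , v) holds in Q m once element a is glued to element b.
Glued : ℕ → ℕ → ℕ → ℕ → ℕ → Set
Glued m a b u v = ZFact m u v ⊎ (u ≡ a × ZFact m b v) ⊎ (u ≡ b × ZFact m a v)

Glued-shift : ∀ {m a b u v} → Glued m a b u v → Glued (suc m) (8 + a) (8 + b) (8 + u) (8 + v)
Glued-shift (inj₁ uv)                = inj₁ (ZFact-shift uv)
Glued-shift (inj₂ (inj₁ (refl , bv))) = inj₂ (inj₁ (refl , ZFact-shift bv))
Glued-shift (inj₂ (inj₂ (refl , av))) = inj₂ (inj₂ (refl , ZFact-shift av))

-- A copy of T in Q m with a glued to b: a path y₀ → y₁ → y₂ → y₃ → y₄.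
GluedT : ℕ → ℕ → ℕ → Set
GluedT m a b = Σ (Fin 5 → ℕ) λ y → ∀ (i : Fin 4) → Glued m a b (y (inject₁ i)) (y (suc i))

spine-fold : ∀ m c → suc (suc c) ≤ m * 4 → GluedT m (spine c) (spine (suc (suc c)))
spine-fold (suc m) 0 _ = lookup (0 ∷ 1 ∷ 4 ∷ 1 ∷ 4 ∷ []) , λ
  { zero                   → inj₁ (first-block 0)
  ; (suc zero)             → inj₁ (first-block 3)
  ; (suc (suc zero))       → inj₂ (inj₂ (refl , first-block 0))
  ; (suc (suc (suc zero))) → inj₁ (first-block 3) }
spine-fold (suc m) 1 _ = lookup (7 ∷ 6 ∷ 5 ∷ 2 ∷ 3 ∷ []) , λ
  { zero                   → inj₁ (first-block 6)
  ; (suc zero)             → inj₁ (first-block 5)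
  ; (suc (suc zero))       → inj₂ (inj₂ (refl , first-block 1))
  ; (suc (suc (suc zero))) → inj₁ (first-block 2) }
spine-fold (suc m) 2 _ = lookup (8 ∷ 5 ∷ 4 ∷ 5 ∷ 4 ∷ []) , λ
  { zero                   → inj₁ (first-block 7)
  ; (suc zero)             → inj₁ (first-block 4)
  ; (suc (suc zero))       → inj₂ (inj₁ (refl , first-block 7))
  ; (suc (suc (suc zero))) → inj₁ (first-block 4) }
spine-fold (suc zero) 3 (s≤s (s≤s (s≤s (s≤s ()))))
spine-fold (suc (suc m)) 3 _ = lookup (7 ∷ 6 ∷ 5 ∷ 10 ∷ 11 ∷ []) , λ
  { zero                   → inj₁ (first-block 6)
  ; (suc zero)             → inj₁ (first-block 5)
  ; (suc (suc zero))       → inj₂ (inj₁ (refl , ZFact-shift (first-block 1)))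
  ; (suc (suc (suc zero))) → inj₁ (ZFact-shift (first-block 2)) }
spine-fold (suc m) (+4 c) (s≤s (s≤s (s≤s (s≤s c+2≤)))) with spine-fold m c c+2≤
... | y , steps = (λ i → 8 + y i) , λ i → Glued-shift (steps i)

InjectiveBelow : {A : Set} → (ℕ → A) → ℕ → Set
InjectiveBelow X n = ∀ s t → s < n → t < n → X s ≡ X t → s ≡ t

module _ {K : ℕ} (X : ℕ → Fin K) where

  FirstRepetitionBelow : ℕ → Set
  FirstRepetitionBelow n = Σ ℕ λ s → Σ ℕ λ t → s < t × t < n × X s ≡ X t × InjectiveBelow X t

  occurs-below : ∀ v n → (Σ ℕ λ s → s < n × X s ≡ v) ⊎ (∀ s → s < n → ¬ X s ≡ v)
  occurs-below v zero = inj₂ (λ s ())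
  occurs-below v (suc n) with occurs-below v n | X n ≟ᶠ v
  ... | inj₁ (s , s<n , eq) | _      = inj₁ (s , <-trans s<n (n<1+n n) , eq)
  ... | inj₂ _              | yes eq = inj₁ (n , n<1+n n , eq)
  ... | inj₂ absent         | no ≢v  = inj₂ absent′
    where
    absent′ : ∀ s → s < suc n → ¬ X s ≡ v
    absent′ s s<1+n with m<1+n⇒m<n∨m≡n s<1+n
    ... | inj₁ s<n  = absent s s<n
    ... | inj₂ refl = ≢v

  injective-or-repeats : ∀ n → InjectiveBelow X n ⊎ FirstRepetitionBelow n
  injective-or-repeats zero = inj₁ (λ s t ())
  injective-or-repeats (suc n) with injective-or-repeats n
  ... | inj₂ (s , t , s<t , t<n , eq , inj) = inj₂ (s , t , s<t , <-trans t<n (n<1+n n) , eq , inj)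
  ... | inj₁ inj with occurs-below (X n) n
  ...   | inj₁ (s , s<n , eq) = inj₂ (s , n , s<n , n<1+n n , eq , inj)
  ...   | inj₂ absent         = inj₁ inj′
    where
    inj′ : InjectiveBelow X (suc n)
    inj′ s t s< t< eq with m<1+n⇒m<n∨m≡n s< | m<1+n⇒m<n∨m≡n t<
    ... | inj₁ s<n  | inj₁ t<n  = inj s t s<n t<n eq
    ... | inj₁ s<n  | inj₂ refl = ⊥-elim (absent s s<n eq)
    ... | inj₂ refl | inj₁ t<n  = ⊥-elim (absent t t<n (sym eq))
    ... | inj₂ refl | inj₂ refl = refl

  -- Pigeonhole: X 0, …, X K cannot be distinct.
  first-repetition : FirstRepetitionBelow (suc K)
  first-repetition with injective-or-repeats (suc K)
  ... | inj₂ rep = rep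
  ... | inj₁ inj with pigeonhole (n<1+n K) (λ i → X (toℕ i))
  ...   | i , j , i<j , eq = ⊥-elim (<⇒≢ i<j (inj _ _ (toℕ<n i) (toℕ<n j) eq))

∘-hom : ∀ {A B C} → Hom B C → Hom A B → Hom A C
∘-hom (g , g-hom) (f , f-hom) = (λ x → g (f x)) , λ a b a,b∈ → g-hom _ _ (f-hom a b a,b∈)

id-hom : ∀ {A} → Hom A A
id-hom = (λ x → x) , λ a b a,b∈ → a,b∈

fact-traversals : ∀ {N x y} → (x , y) ∈ facts N → Traversal N x y × Traversal N y x
fact-traversals {N} {x} {y} x,y∈ =
  ((index x,y∈ , zero) , cong proj₁ at , cong proj₂ at) ,
  ((index x,y∈ , suc zero) , cong proj₂ at , cong proj₁ at)
  where
  at : List.lookup (facts N) (index x,y∈) ≡ (x , y)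
  at = sym (lookup-index x,y∈)

-- The image of the spine cannot
-- fold (that would give T ↦ N), so its first repetition closes a cycle.
module SpineImage (m : ℕ) (N : Structure) (h : Hom (Q m) N) (T↛N : ¬ Hom T N)
  (small : size N ≤ m * 4) where

  image : ℕ → Elem N
  image x = proj₁ h (clamp (m * 8) x)

  image-fact : ∀ {u v} → ZFact m u v → (image u , image v) ∈ facts N
  image-fact uv = proj₂ h _ _ (Q-fact⁺ m uv)

  glued-image-fact : ∀ {a b u v} → image a ≡ image b → Glued m a b u v → (image u , image v) ∈ facts N
  glued-image-fact a≡b (inj₁ uv)                = image-fact uv
  glued-image-fact {v = v} a≡b (inj₂ (inj₁ (refl , bv))) = subst (λ z → (z , image v) ∈ facts N) (sym a≡b) (image-fact bv)
  glued-image-fact {v = v} a≡b (inj₂ (inj₂ (refl , av))) = subst (λ z → (z , image v) ∈ facts N) a≡b (image-fact av)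

  X : ℕ → Elem N
  X t = image (spine t)

  no-fold : ∀ c → suc (suc c) ≤ m * 4 → ¬ X c ≡ X (suc (suc c))
  no-fold c c+2≤ folds with spine-fold m c c+2≤
  ... | y , steps = T↛N ((λ i → image (y i)) , T-hom)
    where
    T-hom : IsHom T N (λ i → image (y i))
    T-hom _ _ (here refl)                         = glued-image-fact folds (steps zero)
    T-hom _ _ (there (here refl))                 = glued-image-fact folds (steps (suc zero))
    T-hom _ _ (there (there (here refl)))         = glued-image-fact folds (steps (suc (suc zero)))
    T-hom _ _ (there (there (there (here refl)))) = glued-image-fact folds (steps (suc (suc (suc zero))))

  spine-traversal : ∀ t → t < m * 4 → Traversal N (X t) (X (suc t))
  spine-traversal t t< with spine-fact m t t<
  ... | inj₁ forward  = proj₁ (fact-traversals (image-fact forward))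
  ... | inj₂ backward = proj₂ (fact-traversals (image-fact backward))

  -- the image of the spine from its first repetition X s ≡ X t is a closed walk
  cycle : Cycle N
  cycle with first-repetition X
  ... | s , t , s<t , t≤K , Xs≡Xt , inj =
    ClosedWalk.cycle N (t ∸ s) (m<n⇒0<n∸m s<t) (λ u → X (u + s))
      (λ u u< → spine-traversal (u + s) (<-≤-trans (below-t u<) t≤4m))
      (trans (cong X d+s≡t) (sym Xs≡Xt))
      (λ a b a< b< eq → +-cancelʳ-≡ s a b (inj _ _ (below-t a<) (below-t b<) eq))
      (λ u u+2≤ → no-fold (u + s) (≤-trans (subst (suc (suc u) + s ≤_) d+s≡t (+-monoˡ-≤ s u+2≤)) t≤4m))
    where
    t≤4m : t ≤ m * 4
    t≤4m = ≤-trans (≤-pred t≤K) small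
    d+s≡t : t ∸ s + s ≡ t
    d+s≡t = m∸n+n≡m (<⇒≤ s<t)
    below-t : ∀ {u} → u < t ∸ s → u + s < t
    below-t u< = subst (_ <_) d+s≡t (+-monoˡ-< s u<)

Q-rejects : ∀ m N → Acyclic N → ¬ Hom T N → size N ≤ m * 4 → ¬ Hom (Q m) N
Q-rejects m N acyclic T↛N small h = acyclic (SpineImage.cycle m N h T↛N small)

total-size : List Structure → ℕ
total-size []       = 0
total-size (A ∷ As) = size A + total-size As

size≤total : ∀ As → All (λ A → size A ≤ total-size As) As
size≤total []       = []
size≤total (A ∷ As) = m≤m+n _ _ ∷ All.map (λ le → ≤-trans le (m≤n+m _ (size A))) (size≤total As)

-- Q m is an acyclic connected CQ fitting the examples, so uniqueness makes
-- it equivalent to T; since Q m holds in itself, T would map to Q m.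
theorem4p7 : (Ep En : List Structure) → All Acyclic Ep → All Acyclic En →
    ¬ UniquelyCharacterizes Ep En T AcyclicConnectedCQ
theorem4p7 Ep En _ En-acyclic ((T⊨Ep , T⊭En) , unique) =
  T↛Q m (Equivalence.from (unique (Q m) (Q-acyclic m , Q-connected m) Q-fits (Q m)) id-hom)
  where
  -- larger than every negative example
  m : ℕ
  m = suc (total-size En)

  small : All (λ A → size A ≤ m * 4) En
  small = All.map (λ le → ≤-trans le (≤-trans (m≤m*n _ 4) (m≤n+m _ 4))) (size≤total En)

  Q-fits : Fits Ep En (Q m)
  Q-fits = All.map (λ T→A → ∘-hom T→A (Q→T m)) T⊨Ep
         , All.zipWith (λ { ((acyclic , T↛A) , size≤) → Q-rejects m _ acyclic T↛A size≤ })
             (All.zip (En-acyclic , T⊭En) , small)
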